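{- Let $r\ge1$ be an integer and $\alpha=[0;2,\overline{r}]$. Let $q_0=1$, $q_1=2$, $q_j=rq_{j-1}+q_{j-2}$ ($j\ge2$); let $s_{ -1}=b$, $s_0=a$, $s_1=ab$, $s_j=s_{j-1}^{r}s_{j-2}$ ($j\ge2$); let $\sigma$ be the morphism $\sigma(a)=ab$, $\sigma(b)=(ab)^{r-1}a$. Define the adjoining singular words $v_{ -1}=a$ and, for $j\ge0$, $v_j=a\,s_{j+1}^{r-1}s_j\,b^{ -1}$ if $j$ is odd and $v_j=b\,s_{j+1}^{r-1}s_j\,a^{ -1}$ if $j$ is even. Let $k,m$ be nonnegative integers with $k=q_{m+1}-p$, where $2\le p\le q_{m+1}-q_m+1$. Then $$(\sigma^m)_k(c_\alpha)=u^{ -1}v_{m-1}\prod_{j=m}^{\infty}v_j,$$ where $u$ is the prefix of $v_{m-1}$ of length $q_{m+1}-q_m+1-p$.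
   Context: Words are over $\{a,b\}$. For words, $wv^{ -1}$ (resp. $u^{ -1}w$) denotes $w$ with its suffix $v$ (resp. prefix $u$) removed, defined when $v$ is a suffix (resp. $u$ a prefix); similarly $u^{ -1}x$ for an infinite word $x$ with prefix $u$. For irrational $\gamma\in(0,1)$, the characteristic Sturmian word $c_\gamma$ is defined by $c_\gamma(i)=a$ if $\lfloor (i+2)\gamma\rfloor-\lfloor (i+1)\gamma\rfloor=0$ and $b$ otherwise ($i\ge0$). Right conjugates: if $\psi,\xi$ are morphisms and there is a word $u$ with $\psi(w)u=u\xi(w)$ for all words $w$, then $\xi$ is the $|u|$-th right conjugate $\psi_{|u|}$ of $\psi$. $\sigma^0$ is the identity. Infinite products denote infinite concatenations. -}

module Defs where

open import Data.Nat as ℕ using (ℕ; zero; suc; _+_; _*_; _∸_)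
open import Data.Integer as ℤ using (ℤ; +_; _-_)
open import Data.Bool using (Bool; true; false; if_then_else_; _∧_)
open import Data.List using (List; []; _∷_; _++_; concat; concatMap; replicate; length; filter; map; drop)
open import Data.Product using (_×_; Σ; _,_)
open import Data.Unit using (⊤)
open import Relation.Binary.PropositionalEquality using (_≡_)
open import Relation.Nullary.Decidable using (⌊_⌋)
open import Function using (_∘_)

data Letter : Set where
  a b : Letter

Word : Set
Word = List Letter

InfWord : Set
InfWord = ℕ → Letter

Morphism : Set
Morphism = Letter → Word

apply : Morphism → Word → Word
apply ψ w = concatMap ψ w

idM : Morphism
idM x = x ∷ []

pow : Morphism → ℕ → Morphism
pow ψ zero = idM
pow ψ (suc m) x = apply ψ (pow ψ m x)

_^ʷ_ : Word → ℕ → Word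
w ^ʷ n = concat (replicate n w)

-- w x^{-1} for a single letter x (removal of the last letter; used only
-- where the last letter is x)
dropLast : Word → Word
dropLast [] = []
dropLast (x ∷ []) = []
dropLast (x ∷ y ∷ xs) = x ∷ dropLast (y ∷ xs)

takeω : ℕ → InfWord → Word
takeω zero x = []
takeω (suc n) x = x 0 ∷ takeω n (x ∘ suc)

_≼_ : Word → InfWord → Set
[] ≼ y = ⊤
(c ∷ w) ≼ y = (c ≡ y 0) × (w ≼ (y ∘ suc))

-- y = ξ(x) for a (non-erasing) morphism ξ and infinite word x
IsImage : Morphism → InfWord → InfWord → Set
IsImage ξ x y = ∀ n → apply ξ (takeω n x) ≼ y

prodUpTo : (ℕ → Word) → ℕ → Word
prodUpTo ws zero = []
prodUpTo ws (suc n) = prodUpTo ws n ++ ws n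

IsInfProd : (ℕ → Word) → InfWord → Set
IsInfProd ws y = ∀ n → prodUpTo ws n ≼ y

q : ℕ → ℕ → ℕ
q r zero = 1
q r (suc zero) = 2
q r (suc (suc j)) = r * q r (suc j) + q r j

-- s' r n = s_{n-1}  (so s' r 0 = s_{-1} = b, s' r 1 = s_0 = a, s' r 2 = s_1 = ab)
s' : ℕ → ℕ → Word
s' r zero = b ∷ []
s' r (suc zero) = a ∷ []
s' r (suc (suc zero)) = a ∷ b ∷ []
s' r (suc (suc (suc n))) = (s' r (suc (suc n)) ^ʷ r) ++ s' r (suc n)

s : ℕ → ℕ → Word
s r j = s' r (suc j)

σ : ℕ → Morphism
σ r a = a ∷ b ∷ []
σ r b = ((a ∷ b ∷ []) ^ʷ (r ∸ 1)) ++ (a ∷ [])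

odd : ℕ → Bool
odd zero = false
odd (suc n) = not' (odd n)
  where
  not' : Bool → Bool
  not' true = false
  not' false = true

v : ℕ → ℕ → Word
v r j = (if odd j then a else b) ∷ dropLast ((s r (suc j) ^ʷ (r ∸ 1)) ++ s r j)

-- v' r n = v_{n-1}  (v' r 0 = v_{-1} = a)
v' : ℕ → ℕ → Word
v' r zero = a ∷ []
v' r (suc j) = v r j

-- Since [0; r, r, ...] = (√(r²+4) − r)/2, we have α = 2 / (4 − r + √(r²+4)).
-- For m, n ≥ 1:  m < nα  ⇔  m √D < R  with D = r²+4, R = 2n − m(4 − r)
--                         ⇔  0 < R  ∧  m² D < R²     (exact integer test).

ltα : ℕ → ℕ → ℕ → Bool
ltα r m n =
  let R = (+ (2 * n)) ℤ.+ (+ (m * r)) - (+ (4 * m))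
      D = r * r + 4
  in ⌊ +0< R ⌋ ∧ ⌊ (+ (m * m * D)) ℤ.<? (R ℤ.* R) ⌋
  where
  +0< : (R : ℤ) → _
  +0< R = (+ 0) ℤ.<? R

range1 : ℕ → List ℕ
range1 zero = []
range1 (suc n) = range1 n ++ (suc n ∷ [])

count : List Bool → ℕ
count [] = 0
count (true ∷ xs) = suc (count xs)
count (false ∷ xs) = count xs

-- ⌊ n α ⌋ = #{ m ∈ {1..n} : m < n α }   (α ∈ (0,1) irrational)
floorα : ℕ → ℕ → ℕ
floorα r n = count (map (λ m → ltα r m n) (range1 n))

cα : ℕ → InfWord
cα r i = if ⌊ floorα r (suc (suc i)) ℕ.≟ floorα r (suc i) ⌋ then a else b

-- the factors of  u^{-1} v_{m-1} ∏_{j ≥ m} v_j  where |u| = ℓ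
rhsSeq : ℕ → ℕ → ℕ → ℕ → Word
rhsSeq r m ℓ zero = drop ℓ (v' r m)
rhsSeq r m ℓ (suc i) = v' r (suc (m + i))

-- With β = [0; r, r, …], the positive root of β² + rβ = 1, we have α = 1/(2 + β). The b's of
-- c_α and c_β sit at the positions ⌊k/α⌋ − 1 and ⌊k/β⌋ − 1, and 1/α = 2 + β, 1/β = r + β then give
-- c_α = ν(c_β) and c_β = φ(c_β) for ν : a ↦ ab, b ↦ aba and φ : a ↦ a^{r−1}b, b ↦ a^{r−1}ba.
-- Since σν = νφ, every standard word s_j = σ^j(a) is a prefix of c_α, so σ^m maps prefixes of c_α
-- to prefixes of c_α. As s_{j+1}s_j and s_j s_{j+1} differ only in their last two letters and
-- k ≤ q_{m+1} − 2, the prefix u of c_α of length k is a prefix of σ^m(x)u for both letters x; hence u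
-- conjugates σ^m to a morphism ξ with ξ(c_α) = u⁻¹σ^m(c_α) = u⁻¹c_α. Finally, writing w⁻ for w without
-- its last letter, s_{j+1}⁻ = s_j⁻ v_{j−1}, so c_α = s_m⁻ v_{m−1} v_m v_{m+1} ⋯ with |s_m⁻| = q_m − 1 ≤ k.

module Submission where

open import Defs
open import Data.Bool using (Bool; true; false; if_then_else_; _∧_)
import Data.Integer as ℤ
import Data.Integer.Properties as ℤₚ
open import Data.List using ([]; _∷_; _++_; length; drop; replicate; map; [_])
open import Data.List.Properties using (length-++; ++-assoc; ++-identityʳ; ++-cancelˡ; ∷-injective; concatMap-++; concatMap-pure; concatMap-cong; map-++; length-++-≤ʳ; length-replicate)
open import Data.Nat as ℕ using (ℕ; zero; suc; _+_; _*_; _∸_; _≤_; _<_; _≤?_; _<?_; _≟_; z≤n; s≤s; s≤s⁻¹)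
open import Data.Nat.Properties
open import Data.Nat.Induction using (<-rec)
open import Data.Nat.Tactic.RingSolver using (solve-∀)
open import Data.Product using (Σ; ∃; _×_; _,_; proj₁; proj₂)
open import Data.Sum using (inj₁; inj₂)
open import Data.Unit using (tt)
open import Function using (_∘_)
open import Function.Bundles using (_⇔_; mk⇔; Equivalence)
open import Function.Construct.Composition using () renaming (equivalence to ⇔-trans)
open import Relation.Nullary using (Dec; yes; no)
open import Relation.Nullary.Decidable using (⌊_⌋)
open import Relation.Nullary.Negation using (contradiction)
open import Relation.Binary.PropositionalEquality hiding ([_])

open Equivalence using (to; from)

dropω : ℕ → InfWord → InfWord
dropω k y i = y (k + i)

≼-++⁺ : ∀ u {v y} → u ≼ y → v ≼ dropω (length u) y → (u ++ v) ≼ y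
≼-++⁺ []      _         v≼ = v≼
≼-++⁺ (c ∷ u) (c≡ , u≼) v≼ = c≡ , ≼-++⁺ u u≼ v≼

≼-++⁻ : ∀ u {v y} → (u ++ v) ≼ y → u ≼ y × v ≼ dropω (length u) y
≼-++⁻ []      v≼         = tt , v≼
≼-++⁻ (c ∷ u) (c≡ , uv≼) = (c≡ , proj₁ (≼-++⁻ u uv≼)) , proj₂ (≼-++⁻ u uv≼)

≼-drop : ∀ k w {y} → w ≼ y → drop k w ≼ dropω k y
≼-drop zero    w       w≼       = w≼
≼-drop (suc k) []      _        = tt
≼-drop (suc k) (c ∷ w) (_ , w≼) = ≼-drop k w w≼

takeω-≼ : ∀ n y → takeω n y ≼ y
takeω-≼ zero    y = tt
takeω-≼ (suc n) y = refl , takeω-≼ n (y ∘ suc)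

≼⇒≡takeω : ∀ w {y} → w ≼ y → w ≡ takeω (length w) y
≼⇒≡takeω []      _         = refl
≼⇒≡takeω (c ∷ w) (c≡ , w≼) = cong₂ _∷_ c≡ (≼⇒≡takeω w w≼)

length-takeω : ∀ n y → length (takeω n y) ≡ n
length-takeω zero    y = refl
length-takeω (suc n) y = cong suc (length-takeω n (y ∘ suc))

takeω-suc : ∀ n y → takeω (suc n) y ≡ takeω n y ++ [ y n ]
takeω-suc zero    y = refl
takeω-suc (suc n) y = cong (y 0 ∷_) (takeω-suc n (y ∘ suc))

takeω-+ : ∀ n k y → takeω (n + k) y ≡ takeω n y ++ takeω k (dropω n y)
takeω-+ zero    k y = refl
takeω-+ (suc n) k y = cong (y 0 ∷_) (takeω-+ n k (y ∘ suc))

infix 4 _⊑_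

_⊑_ : Word → Word → Set
u ⊑ w = ∃ λ t → u ++ t ≡ w

⊑-refl : ∀ w → w ⊑ w
⊑-refl w = [] , ++-identityʳ w

⊑-trans : ∀ {u v w} → u ⊑ v → v ⊑ w → u ⊑ w
⊑-trans {u} (t , refl) (t′ , refl) = t ++ t′ , sym (++-assoc u t t′)

⊑-++ : ∀ u v → u ⊑ u ++ v
⊑-++ u v = v , refl

∷-⊑ : ∀ x {u w} → u ⊑ w → x ∷ u ⊑ x ∷ w
∷-⊑ x (t , e) = t , cong (x ∷_) e

++⁺-⊑ : ∀ x {u w} → u ⊑ w → x ++ u ⊑ x ++ w
++⁺-⊑ x {u} (t , refl) = t , ++-assoc x u t

++⁻-⊑ : ∀ x {u w} → x ++ u ⊑ x ++ w → u ⊑ w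
++⁻-⊑ x {u} (t , e) = t , ++-cancelˡ x (u ++ t) _ (trans (sym (++-assoc x u t)) e)

⊑-++-shorter : ∀ x y {z} → x ⊑ y ++ z → length x ≤ length y → x ⊑ y
⊑-++-shorter []      y       _       _         = y , refl
⊑-++-shorter (c ∷ x) (d ∷ y) (t , e) (s≤s |x|≤|y|)
  with refl , e′ ← ∷-injective e = ∷-⊑ c (⊑-++-shorter x y (t , e′) |x|≤|y|)

⊑-≼ : ∀ {u w y} → u ⊑ w → w ≼ y → u ≼ y
⊑-≼ {u} (t , refl) uv≼ = proj₁ (≼-++⁻ u uv≼)

≼-≼⇒⊑ : ∀ u w {y} → u ≼ y → w ≼ y → length u ≤ length w → u ⊑ w
≼-≼⇒⊑ []      w       _         _         _          = w , refl
≼-≼⇒⊑ (c ∷ u) (d ∷ w) (c≡ , u≼) (d≡ , w≼) (s≤s |u|≤|w|) =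
  subst (λ x → c ∷ u ⊑ x ∷ w) (trans c≡ (sym d≡)) (∷-⊑ c (≼-≼⇒⊑ u w u≼ w≼ |u|≤|w|))

apply-apply : ∀ φ ψ w → apply φ (apply ψ w) ≡ apply (apply φ ∘ ψ) w
apply-apply φ ψ []      = refl
apply-apply φ ψ (x ∷ w) = trans (concatMap-++ φ (ψ x) (apply ψ w)) (cong (apply φ (ψ x) ++_) (apply-apply φ ψ w))

apply-⊑ : ∀ φ {u w} → u ⊑ w → apply φ u ⊑ apply φ w
apply-⊑ φ {u} (t , refl) = apply φ t , sym (concatMap-++ φ u t)

apply-pow : ∀ ψ m n x → apply (pow ψ m) (pow ψ n x) ≡ pow ψ (m + n) x
apply-pow ψ zero    n x = concatMap-pure (pow ψ n x)
apply-pow ψ (suc m) n x = trans (sym (apply-apply ψ (pow ψ m) (pow ψ n x))) (cong (apply ψ) (apply-pow ψ m n x))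

apply-^ʷ : ∀ φ w n → apply φ (w ^ʷ n) ≡ apply φ w ^ʷ n
apply-^ʷ φ w zero    = refl
apply-^ʷ φ w (suc n) = trans (concatMap-++ φ w (w ^ʷ n)) (cong (apply φ w ++_) (apply-^ʷ φ w n))

length-^ʷ : ∀ (w : Word) n → length (w ^ʷ n) ≡ n * length w
length-^ʷ w zero    = refl
length-^ʷ w (suc n) = trans (length-++ w) (cong (length w +_) (length-^ʷ w n))

^ʷ-comm : ∀ (w : Word) n → w ++ w ^ʷ n ≡ w ^ʷ n ++ w
^ʷ-comm w zero    = ++-identityʳ w
^ʷ-comm w (suc n) = trans (cong (w ++_) (^ʷ-comm w n)) (sym (++-assoc w (w ^ʷ n) w))

length-apply-≥ : ∀ φ → (∀ x → 1 ≤ length (φ x)) → ∀ w → length w ≤ length (apply φ w)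
length-apply-≥ φ φ-nonErasing []      = z≤n
length-apply-≥ φ φ-nonErasing (x ∷ w) = subst (suc (length w) ≤_) (sym (length-++ (φ x)))
  (+-mono-≤ (φ-nonErasing x) (length-apply-≥ φ φ-nonErasing w))

#b : Word → ℕ
#b []      = 0
#b (a ∷ w) = #b w
#b (b ∷ w) = suc (#b w)

#b-++ : ∀ u v → #b (u ++ v) ≡ #b u + #b v
#b-++ []      v = refl
#b-++ (a ∷ u) v = #b-++ u v
#b-++ (b ∷ u) v = cong suc (#b-++ u v)

⌊⌋-true⇔ : ∀ {A : Set} (d : Dec A) → ⌊ d ⌋ ≡ true ⇔ A
⌊⌋-true⇔ (yes p) = mk⇔ (λ _ → p) (λ _ → refl)
⌊⌋-true⇔ (no ¬p) = mk⇔ (λ ()) (λ p → contradiction p ¬p)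

count-++ : ∀ xs ys → count (xs ++ ys) ≡ count xs + count ys
count-++ []           ys = refl
count-++ (true ∷ xs)  ys = cong suc (count-++ xs ys)
count-++ (false ∷ xs) ys = count-++ xs ys

module Count (Q : ℕ → Bool) (Q-down : ∀ k → 1 ≤ k → Q (suc k) ≡ true → Q k ≡ true) where

  #Q : ℕ → ℕ
  #Q n = count (map Q (range1 n))

  #Q-suc : ∀ n → #Q (suc n) ≡ #Q n + count [ Q (suc n) ]
  #Q-suc n = trans (cong count (map-++ Q (range1 n) [ suc n ])) (count-++ (map Q (range1 n)) _)

  Q-below : ∀ j k → 1 ≤ k → k ≤ j → Q j ≡ true → Q k ≡ true
  Q-below zero    k 1≤k k≤0 _ = contradiction (≤-trans 1≤k k≤0) λ ()
  Q-below (suc j) k 1≤k k≤j Qj with m≤n⇒m<n∨m≡n k≤j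
  ... | inj₁ k≤j′ = Q-below j k 1≤k (s≤s⁻¹ k≤j′) (Q-down j (≤-trans 1≤k (s≤s⁻¹ k≤j′)) Qj)
  ... | inj₂ refl = Qj

  #Q-all : ∀ n → (∀ k → 1 ≤ k → k ≤ n → Q k ≡ true) → #Q n ≡ n
  #Q-all zero    _   = refl
  #Q-all (suc n) all = begin
    #Q (suc n)                 ≡⟨ #Q-suc n ⟩
    #Q n + count [ Q (suc n) ] ≡⟨ cong (λ x → #Q n + count [ x ]) (all (suc n) (s≤s z≤n) ≤-refl) ⟩
    #Q n + 1                   ≡⟨ cong (_+ 1) (#Q-all n λ k 1≤k k≤n → all k 1≤k (m≤n⇒m≤1+n k≤n)) ⟩
    n + 1                      ≡⟨ +-comm n 1 ⟩
    suc n                      ∎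
    where open ≡-Reasoning

  ≤#Q⇔ : ∀ n k → 1 ≤ k → k ≤ #Q n ⇔ (k ≤ n × Q k ≡ true)
  ≤#Q⇔ zero    k 1≤k = mk⇔ (λ k≤0 → contradiction (≤-trans 1≤k k≤0) λ ()) (λ (k≤0 , _) → k≤0)
  ≤#Q⇔ (suc n) k 1≤k with Q (suc n) in Qn
  ... | true  = mk⇔ (λ k≤ → k≤′ k≤ , Q-below (suc n) k 1≤k (k≤′ k≤) Qn) (λ (k≤ , _) → subst (k ≤_) (sym #Q≡) k≤)
    where
    #Q≡ : #Q (suc n) ≡ suc n
    #Q≡ = #Q-all (suc n) λ j 1≤j j≤ → Q-below (suc n) j 1≤j j≤ Qn
    k≤′ : k ≤ #Q (suc n) → k ≤ suc n
    k≤′ = subst (k ≤_) #Q≡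
  ... | false = mk⇔ (λ k≤ → let k≤n , Qk = to (≤#Q⇔ n k 1≤k) (subst (k ≤_) #Q≡ k≤) in m≤n⇒m≤1+n k≤n , Qk)
                    (λ (k≤ , Qk) → subst (k ≤_) (sym #Q≡) (from (≤#Q⇔ n k 1≤k) (k≤n k≤ Qk , Qk)))
    where
    #Q≡ : #Q (suc n) ≡ #Q n
    #Q≡ = trans (#Q-suc n) (trans (cong (λ x → #Q n + count [ x ]) Qn) (+-identityʳ (#Q n)))
    k≤n : k ≤ suc n → Q k ≡ true → k ≤ n
    k≤n k≤ Qk with m≤n⇒m<n∨m≡n k≤
    ... | inj₁ k<  = s≤s⁻¹ k<
    ... | inj₂ refl = contradiction (trans (sym Qk) Qn) λ ()

-- Arithmetic of β = [0; r, r, …], the positive root of β² + rβ = 1: k < nβ iff k² + knr < n²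

ltβ : ℕ → ℕ → ℕ → Bool
ltβ r k n = ⌊ k * k + k * n * r <? n * n ⌋

floorβ : ℕ → ℕ → ℕ
floorβ r n = count (map (λ k → ltβ r k n) (range1 n))

m*m<n*n⇒m<n : ∀ {m n} → m * m < n * n → m < n
m*m<n*n⇒m<n m*m<n*n = ≰⇒> λ n≤m → <⇒≱ m*m<n*n (*-mono-≤ n≤m n≤m)

-- the conditions at n = rk + M, up to the common summand kMr + (rk)²
β-lhs : ∀ r k M → k * k + k * (r * k + M) * r ≡ k * k + (k * M * r + r * k * (r * k))
β-lhs = solve-∀

β-rhs : ∀ r k M → (r * k + M) * (r * k + M) ≡ (M * M + M * k * r) + (k * M * r + r * k * (r * k))
β-rhs = solve-∀

β-shift-< : ∀ r k M → k * k + k * (r * k + M) * r < (r * k + M) * (r * k + M) ⇔ k * k < M * M + M * k * r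
β-shift-< r k M = mk⇔
  (λ lt → +-cancelʳ-< _ (k * k) _ (subst₂ _<_ (β-lhs r k M) (β-rhs r k M) lt))
  (λ lt → subst₂ _<_ (sym (β-lhs r k M)) (sym (β-rhs r k M)) (+-monoˡ-< _ lt))

β-shift-≡ : ∀ r k M → k * k + k * (r * k + M) * r ≡ (r * k + M) * (r * k + M) → M * M + M * k * r ≡ k * k
β-shift-≡ r k M eq = sym (+-cancelʳ-≡ _ (k * k) _ (trans (sym (β-lhs r k M)) (trans eq (β-rhs r k M))))

-- A solution of K² + Kmr = m² yields the smaller solution (M, K) with m = rK + M.
β-irrational : ∀ r → 1 ≤ r → ∀ m K → 1 ≤ m → K * K + K * m * r ≢ m * m
β-irrational r 1≤r = <-rec (λ m → ∀ K → 1 ≤ m → K * K + K * m * r ≢ m * m) descent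
  where
  descent : ∀ m → (∀ {m′} → m′ < m → ∀ K → 1 ≤ m′ → K * K + K * m′ * r ≢ m′ * m′) →
            ∀ K → 1 ≤ m → K * K + K * m * r ≢ m * m
  descent m _   zero      1≤m eq = <-irrefl eq (*-mono-≤ 1≤m 1≤m)
  descent m rec K@(suc _) 1≤m eq with m≤n⇒∃[o]m+o≡n rK≤m
    where
    rK≤m : r * K ≤ m
    rK≤m = ≮⇒≥ λ m<rK → <-irrefl (sym eq) (begin-strict
      m * m             <⟨ *-monoʳ-< m ⦃ ℕ.>-nonZero 1≤m ⦄ m<rK ⟩
      m * (r * K)       ≡⟨ solve-∀′ m r K ⟩
      K * m * r         ≤⟨ m≤n+m _ (K * K) ⟩
      K * K + K * m * r ∎)
      where
      open ≤-Reasoning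
      solve-∀′ : ∀ m r K → m * (r * K) ≡ K * m * r
      solve-∀′ = solve-∀
  ... | M , refl = rec K<m M (s≤s z≤n) (β-shift-≡ r K M eq)
    where
    K<m : K < r * K + M
    K<m = m*m<n*n⇒m<n (subst (K * K <_) eq (m<m+n (K * K) (*-mono-≤ {1} {K * _} (*-mono-≤ {1} {K} (s≤s z≤n) 1≤m) 1≤r)))

ltβ⇔ : ∀ r k n → ltβ r k n ≡ true ⇔ k * k + k * n * r < n * n
ltβ⇔ r k n = ⌊⌋-true⇔ (k * k + k * n * r <? n * n)

ltβ-down : ∀ r k n → ltβ r (suc k) n ≡ true → ltβ r k n ≡ true
ltβ-down r k n = from (ltβ⇔ r k n) ∘ ≤-<-trans mono ∘ to (ltβ⇔ r (suc k) n)
  where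
  mono : k * k + k * n * r ≤ suc k * suc k + suc k * n * r
  mono = +-mono-≤ (*-mono-≤ (n≤1+n k) (n≤1+n k)) (*-monoˡ-≤ r (*-monoˡ-≤ n (n≤1+n k)))

ltβ⇒≤ : ∀ r k n → ltβ r k n ≡ true → k ≤ n
ltβ⇒≤ r k n = <⇒≤ ∘ m*m<n*n⇒m<n ∘ ≤-<-trans (m≤m+n (k * k) _) ∘ to (ltβ⇔ r k n)

≤floorβ⇔ltβ : ∀ r n k → 1 ≤ k → k ≤ floorβ r n ⇔ ltβ r k n ≡ true
≤floorβ⇔ltβ r n k 1≤k = mk⇔ (proj₂ ∘ to ≤#Q) (λ lt → from ≤#Q (ltβ⇒≤ r k n lt , lt))
  where ≤#Q = Count.≤#Q⇔ (λ j → ltβ r j n) (λ j _ → ltβ-down r j n) n k 1≤k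

sq<⇔floorβ< : ∀ r → 1 ≤ r → ∀ m K → 1 ≤ m → m * m < K * K + K * m * r ⇔ floorβ r m < K
sq<⇔floorβ< r 1≤r m zero      1≤m = mk⇔ (λ ()) (λ ())
sq<⇔floorβ< r 1≤r m K@(suc _) 1≤m = mk⇔
  (λ m²< → ≰⇒> λ K≤ → <-asym m²< (to lt⇔ K≤))
  (λ <K → ≤∧≢⇒< (≮⇒≥ λ lt → <⇒≱ <K (from lt⇔ lt)) (≢-sym (β-irrational r 1≤r m K 1≤m)))
  where
  lt⇔ : K ≤ floorβ r m ⇔ K * K + K * m * r < m * m
  lt⇔ = ⇔-trans (≤floorβ⇔ltβ r m K (s≤s z≤n)) (ltβ⇔ r K m)

-- threshold r 2 k = ⌊k/α⌋ and threshold r r k = ⌊k/β⌋, since 1/α = 2 + β and 1/β = r + β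
threshold : ℕ → ℕ → ℕ → ℕ
threshold r d k = d * k + floorβ r k

ltβ⇔threshold< : ∀ r → 1 ≤ r → ∀ k n → 1 ≤ k → ltβ r k n ≡ true ⇔ threshold r r k < n
ltβ⇔threshold< r 1≤r k n 1≤k with r * k ≤? n
... | no  rk≰n = mk⇔ (λ lt → contradiction (to (ltβ⇔ r k n) lt) (≤⇒≯ n²≤))
                     (λ lt → contradiction (≤-<-trans (m≤m+n (r * k) _) lt) (<-asym (≰⇒> rk≰n)))
  where
  n²≤ : n * n ≤ k * k + k * n * r
  n²≤ = begin
    n * n             ≤⟨ *-monoʳ-≤ n (<⇒≤ (≰⇒> rk≰n)) ⟩
    n * (r * k)       ≡⟨ lemma n r k ⟩
    k * n * r         ≤⟨ m≤n+m _ (k * k) ⟩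
    k * k + k * n * r ∎
    where
    open ≤-Reasoning
    lemma : ∀ n r k → n * (r * k) ≡ k * n * r
    lemma = solve-∀
... | yes rk≤n with m≤n⇒∃[o]m+o≡n rk≤n
... | M , refl = ⇔-trans (ltβ⇔ r k (r * k + M)) (⇔-trans (β-shift-< r k M)
                   (⇔-trans (sq<⇔floorβ< r 1≤r k M 1≤k) (mk⇔ (+-monoʳ-< (r * k)) (+-cancelˡ-< (r * k) _ _))))

≤floorβ⇔threshold< : ∀ r → 1 ≤ r → ∀ n k → 1 ≤ k → k ≤ floorβ r n ⇔ threshold r r k < n
≤floorβ⇔threshold< r 1≤r n k 1≤k = ⇔-trans (≤floorβ⇔ltβ r n k 1≤k) (ltβ⇔threshold< r 1≤r k n 1≤k)

counting-mono : ∀ {F Θ : ℕ → ℕ} → (∀ n k → 1 ≤ k → k ≤ F n ⇔ Θ k < n) → ∀ n → F n ≤ F (suc n)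
counting-mono {F} ≤F⇔ n = mono (F n) ≤-refl
  where
  mono : ∀ k → k ≤ F n → k ≤ F (suc n)
  mono zero    _  = z≤n
  mono (suc k) k≤ = from (≤F⇔ (suc n) (suc k) (s≤s z≤n)) (m<n⇒m<1+n (to (≤F⇔ n (suc k) (s≤s z≤n)) k≤))

floorβ-mono : ∀ r → 1 ≤ r → ∀ n → floorβ r n ≤ floorβ r (suc n)
floorβ-mono r 1≤r = counting-mono (≤floorβ⇔threshold< r 1≤r)

threshold-< : ∀ r → 1 ≤ r → ∀ d → 1 ≤ d → ∀ k → threshold r d k < threshold r d (suc k)
threshold-< r 1≤r d 1≤d k = begin-strict
  d * k + floorβ r k             ≤⟨ +-monoʳ-≤ (d * k) (floorβ-mono r 1≤r k) ⟩
  d * k + floorβ r (suc k)       <⟨ m<n+m _ 1≤d ⟩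
  d + (d * k + floorβ r (suc k)) ≡⟨ sym (+-assoc d (d * k) _) ⟩
  d + d * k + floorβ r (suc k)   ≡⟨ cong (_+ floorβ r (suc k)) (sym (*-suc d k)) ⟩
  d * suc k + floorβ r (suc k)   ∎
  where open ≤-Reasoning

threshold-0 : ∀ r d → threshold r d 0 ≡ 0
threshold-0 r d = trans (+-identityʳ (d * 0)) (*-zeroʳ d)

-- Arithmetic of α = 1/(2 + β), through the integer test in the definition of ltα

∧-true⇔ : ∀ {x y} → x ∧ y ≡ true ⇔ (x ≡ true × y ≡ true)
∧-true⇔ {true}  = mk⇔ (λ y≡ → refl , y≡) proj₂
∧-true⇔ {false} = mk⇔ (λ ()) (λ ())

-- ltα r m n unfolds to ltα-test (m²(r² + 4)) (2n + mr − 4m)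
ltα-test : ℕ → ℤ.ℤ → Bool
ltα-test D R = ⌊ ℤ.+ 0 ℤ.<? R ⌋ ∧ ⌊ ℤ.+ D ℤ.<? R ℤ.* R ⌋

ltα-test-+⇔ : ∀ D t → ltα-test D (ℤ.+ t) ≡ true ⇔ D < t * t
ltα-test-+⇔ D t = mk⇔
  (λ h → ℤₚ.drop‿+<+ (subst (ℤ.+ D ℤ.<_) (sym (ℤₚ.pos-* t t))
            (to (⌊⌋-true⇔ (ℤ.+ D ℤ.<? ℤ.+ t ℤ.* ℤ.+ t)) (proj₂ (to ∧-true⇔ h)))))
  (λ D<t² → from ∧-true⇔ ( from (⌊⌋-true⇔ (ℤ.+ 0 ℤ.<? ℤ.+ t)) (ℤ.+<+ (positive D<t²))
                         , from (⌊⌋-true⇔ (ℤ.+ D ℤ.<? ℤ.+ t ℤ.* ℤ.+ t))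
                                (subst (ℤ.+ D ℤ.<_) (ℤₚ.pos-* t t) (ℤ.+<+ D<t²))))
  where
  positive : D < t * t → 0 < t
  positive D<t² = m*m<n*n⇒m<n {0} {t} (≤-<-trans z≤n D<t²)

ltα⇔ : ∀ r m n → ltα r m n ≡ true ⇔ ∃ λ t → 4 * m + t ≡ 2 * n + m * r × m * m * (r * r + 4) < t * t
ltα⇔ r m n with 4 * m ≤? 2 * n + m * r
... | no 4m≰ = mk⇔ (λ h → contradiction (to (⌊⌋-true⇔ (ℤ.+ 0 ℤ.<? R)) (proj₁ (to ∧-true⇔ h))) (ℤₚ.≤⇒≯ R≤0))
                   (λ (t , e , _) → contradiction (subst (4 * m ≤_) e (m≤m+n (4 * m) t)) 4m≰)
  where
  R = ℤ.+ (2 * n + m * r) ℤ.- ℤ.+ (4 * m)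
  R≤0 : R ℤ.≤ ℤ.+ 0
  R≤0 = subst (ℤ._≤ ℤ.+ 0) (sym (trans (ℤₚ.m-n≡m⊖n (2 * n + m * r) (4 * m)) (ℤₚ.⊖-≰ 4m≰))) ℤₚ.neg-≤-pos
... | yes 4m≤ with m≤n⇒∃[o]m+o≡n 4m≤
... | t , e = mk⇔
  (λ h → t , e , to (ltα-test-+⇔ D t) (subst (λ R → ltα-test D R ≡ true) R≡+t h))
  (λ (t′ , e′ , lt) → subst (λ R → ltα-test D R ≡ true) (sym R≡+t)
     (from (ltα-test-+⇔ D t) (subst (λ x → D < x * x) (+-cancelˡ-≡ (4 * m) t′ t (trans e′ (sym e))) lt)))
  where
  D = m * m * (r * r + 4)
  R≡+t : ℤ.+ (2 * n + m * r) ℤ.- ℤ.+ (4 * m) ≡ ℤ.+ t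
  R≡+t = begin
    ℤ.+ (2 * n + m * r) ℤ.- ℤ.+ (4 * m) ≡⟨ ℤₚ.m-n≡m⊖n (2 * n + m * r) (4 * m) ⟩
    (2 * n + m * r) ℤ.⊖ 4 * m           ≡⟨ cong (ℤ._⊖ (4 * m)) (sym e) ⟩
    (4 * m + t) ℤ.⊖ 4 * m               ≡⟨ ℤₚ.≤-⊖ (m≤m+n (4 * m) t) ⟩
    ℤ.+ (4 * m + t ∸ 4 * m)             ≡⟨ cong ℤ.+_ (m+n∸m≡n (4 * m) t) ⟩
    ℤ.+ t                               ∎
    where open ≡-Reasoning

-- the test at n = 2m + K, up to the common summand (mr)²
α-lhs : ∀ r m → m * m * (r * r + 4) ≡ 4 * (m * m) + m * r * (m * r)
α-lhs = solve-∀

α-rhs : ∀ r m K → (2 * K + m * r) * (2 * K + m * r) ≡ 4 * (K * K + K * m * r) + m * r * (m * r)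
α-rhs = solve-∀

α-shift-< : ∀ r m K → m * m * (r * r + 4) < (2 * K + m * r) * (2 * K + m * r) ⇔ m * m < K * K + K * m * r
α-shift-< r m K = mk⇔
  (λ lt → *-cancelˡ-< 4 _ _ (+-cancelʳ-< _ _ _ (subst₂ _<_ (α-lhs r m) (α-rhs r m K) lt)))
  (λ lt → subst₂ _<_ (sym (α-lhs r m)) (sym (α-rhs r m K)) (+-monoˡ-< _ (*-monoʳ-< 4 lt)))

ltα⇔threshold< : ∀ r → 1 ≤ r → ∀ m n → 1 ≤ m → ltα r m n ≡ true ⇔ threshold r 2 m < n
ltα⇔threshold< r 1≤r m n 1≤m with 2 * m ≤? n
... | no 2m≰n = mk⇔ (λ h → let t , e , lt = to (ltα⇔ r m n) h in contradiction lt (≤⇒≯ (D≥ t e)))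
                    (λ lt → contradiction (≤-<-trans (m≤m+n (2 * m) _) lt) (<-asym (≰⇒> 2m≰n)))
  where
  D≥ : ∀ t → 4 * m + t ≡ 2 * n + m * r → t * t ≤ m * m * (r * r + 4)
  D≥ t e = begin
    t * t                         ≤⟨ *-mono-≤ t≤mr t≤mr ⟩
    m * r * (m * r)               ≤⟨ m≤n+m _ (4 * (m * m)) ⟩
    4 * (m * m) + m * r * (m * r) ≡⟨ sym (α-lhs r m) ⟩
    m * m * (r * r + 4)           ∎
    where
    open ≤-Reasoning
    2n≤4m : 2 * n ≤ 4 * m
    2n≤4m = subst (2 * n ≤_) (solve-∀′ m) (*-monoʳ-≤ 2 (<⇒≤ (≰⇒> 2m≰n)))
      where
      solve-∀′ : ∀ m → 2 * (2 * m) ≡ 4 * m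
      solve-∀′ = solve-∀
    t≤mr : t ≤ m * r
    t≤mr = +-cancelˡ-≤ (4 * m) t (m * r) (subst (_≤ 4 * m + m * r) (sym e) (+-monoˡ-≤ (m * r) 2n≤4m))
... | yes 2m≤n with m≤n⇒∃[o]m+o≡n 2m≤n
... | K , refl = ⇔-trans (ltα⇔ r m (2 * m + K)) (⇔-trans witness⇔ (⇔-trans (α-shift-< r m K)
                   (⇔-trans (sq<⇔floorβ< r 1≤r m K 1≤m) (mk⇔ (+-monoʳ-< (2 * m)) (+-cancelˡ-< (2 * m) _ _)))))
  where
  shift : ∀ m K r → 2 * (2 * m + K) + m * r ≡ 4 * m + (2 * K + m * r)
  shift = solve-∀
  witness⇔ : (∃ λ t → 4 * m + t ≡ 2 * (2 * m + K) + m * r × m * m * (r * r + 4) < t * t) ⇔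
             m * m * (r * r + 4) < (2 * K + m * r) * (2 * K + m * r)
  witness⇔ = mk⇔ (λ (t , e , lt) → subst (λ x → _ < x * x) (+-cancelˡ-≡ (4 * m) t _ (trans e (shift m K r))) lt)
                 (λ lt → 2 * K + m * r , sym (shift m K r) , lt)

ltα-down : ∀ r → 1 ≤ r → ∀ k n → 1 ≤ k → ltα r (suc k) n ≡ true → ltα r k n ≡ true
ltα-down r 1≤r k n 1≤k = from (ltα⇔threshold< r 1≤r k n 1≤k)
                       ∘ <-trans (threshold-< r 1≤r 2 (s≤s z≤n) k)
                       ∘ to (ltα⇔threshold< r 1≤r (suc k) n (s≤s z≤n))

≤floorα⇔threshold< : ∀ r → 1 ≤ r → ∀ n k → 1 ≤ k → k ≤ floorα r n ⇔ threshold r 2 k < n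
≤floorα⇔threshold< r 1≤r n k 1≤k = mk⇔
  (to lt⇔ ∘ proj₂ ∘ to ≤#Q)
  (λ lt → from ≤#Q (<⇒≤ (≤-<-trans (≤-trans (m≤m+n k (k + 0)) (m≤m+n (2 * k) _)) lt) , from lt⇔ lt))
  where
  lt⇔ = ltα⇔threshold< r 1≤r k n 1≤k
  ≤#Q = Count.≤#Q⇔ (λ j → ltα r j n) (λ j 1≤j → ltα-down r 1≤r j n 1≤j) n k 1≤k

mechanical : (ℕ → ℕ) → InfWord
mechanical F i = if ⌊ F (suc (suc i)) ≟ F (suc i) ⌋ then a else b

-- F counts the k ≥ 1 with Θ k < n, so the b's of the word sit at the positions Θ k − 1
module Mechanical (F Θ : ℕ → ℕ) (≤F⇔ : ∀ n k → 1 ≤ k → k ≤ F n ⇔ Θ k < n)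
                  (Θ-< : ∀ k → Θ k < Θ (suc k)) (Θ-0 : Θ 0 ≡ 0) where

  F≡ : ∀ n k → Θ k < n → n ≤ Θ (suc k) → F n ≡ k
  F≡ n k Θk<n n≤Θk+1 = ≤-antisym F≤ (k≤F k Θk<n)
    where
    F≤ : F n ≤ k
    F≤ = ≮⇒≥ λ k<F → <⇒≱ (to (≤F⇔ n (suc k) (s≤s z≤n)) k<F) n≤Θk+1
    k≤F : ∀ k → Θ k < n → k ≤ F n
    k≤F zero    _   = z≤n
    k≤F (suc k) lt = from (≤F⇔ n (suc k) (s≤s z≤n)) lt

  Θ-F< : ∀ n → 1 ≤ n → Θ (F n) < n
  Θ-F< n 1≤n with F n in eq
  ... | zero  = subst (_< n) (sym Θ-0) 1≤n
  ... | suc k = to (≤F⇔ n (suc k) (s≤s z≤n)) (≤-reflexive (sym eq))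

  ≤Θ-F : ∀ n → n ≤ Θ (suc (F n))
  ≤Θ-F n = ≮⇒≥ λ lt → <-irrefl refl (from (≤F⇔ n (suc (F n)) (s≤s z≤n)) lt)

  mechanical-b : ∀ i k → 1 ≤ k → suc i ≡ Θ k → mechanical F i ≡ b
  mechanical-b i k 1≤k i+1≡ with F (suc (suc i)) ≟ F (suc i)
  ... | no  _  = refl
  ... | yes eq = contradiction (to (≤F⇔ (suc i) k 1≤k) (subst (k ≤_) eq k≤F)) (<-irrefl (sym i+1≡))
    where
    k≤F : k ≤ F (suc (suc i))
    k≤F = from (≤F⇔ (suc (suc i)) k 1≤k) (s≤s (≤-reflexive (sym i+1≡)))

  mechanical-a : ∀ i k → Θ k < suc i → suc i < Θ (suc k) → mechanical F i ≡ a
  mechanical-a i k Θk< <Θk+1 with F (suc (suc i)) ≟ F (suc i)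
  ... | yes _  = refl
  ... | no  ne = contradiction (trans (F≡ (suc (suc i)) k (m<n⇒m<1+n Θk<) <Θk+1) (sym (F≡ (suc i) k Θk< (<⇒≤ <Θk+1)))) ne

  F-suc-suc : ∀ n → F (suc (suc n)) ≡ F (suc n) + #b [ mechanical F n ]
  F-suc-suc n with F (suc (suc n)) ≟ F (suc n)
  ... | yes eq = trans eq (sym (+-identityʳ _))
  ... | no  ne = trans (F≡ (suc (suc n)) (suc k) (s≤s (≤-reflexive Θk+1≡)) Θk+2≥) (+-comm 1 k)
    where
    k = F (suc n)
    Θk+1≡ : Θ (suc k) ≡ suc n
    Θk+1≡ with m≤n⇒m<n∨m≡n (≤Θ-F (suc n))
    ... | inj₂ eq = sym eq
    ... | inj₁ lt = contradiction (F≡ (suc (suc n)) k (m<n⇒m<1+n (Θ-F< (suc n) (s≤s z≤n))) lt) ne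
    Θk+2≥ : suc (suc n) ≤ Θ (suc (suc k))
    Θk+2≥ = subst (λ x → suc x ≤ Θ (suc (suc k))) Θk+1≡ (Θ-< (suc k))

  F-b : ∀ n → mechanical F n ≡ b → F (suc (suc n)) ≡ suc (F (suc n))
  F-b n eq = trans (F-suc-suc n) (trans (cong (λ x → F (suc n) + #b [ x ]) eq) (+-comm (F (suc n)) 1))

  #b-takeω : ∀ n → #b (takeω n (mechanical F)) ≡ F (suc n)
  #b-takeω zero    = sym (F≡ 1 0 (subst (_< 1) (sym Θ-0) (s≤s z≤n)) (subst (_< Θ 1) Θ-0 (Θ-< 0)))
  #b-takeω (suc n) = begin
    #b (takeω (suc n) W)        ≡⟨ cong #b (takeω-suc n W) ⟩
    #b (takeω n W ++ [ W n ])   ≡⟨ #b-++ (takeω n W) _ ⟩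
    #b (takeω n W) + #b [ W n ] ≡⟨ cong (_+ #b [ W n ]) (#b-takeω n) ⟩
    F (suc n) + #b [ W n ]      ≡⟨ sym (F-suc-suc n) ⟩
    F (suc (suc n))             ∎
    where
    open ≡-Reasoning
    W = mechanical F

-- c_α and c_β as images of c_β

ψ : ℕ → Morphism
ψ e a = replicate e a ++ b ∷ []
ψ e b = replicate e a ++ b ∷ a ∷ []

length-ψ : ∀ e w → length (apply (ψ e) w) ≡ suc e * length w + #b w
length-ψ e []      = sym (trans (+-identityʳ (e * 0)) (*-zeroʳ e))
length-ψ e (x ∷ w) = begin
  length (ψ e x ++ apply (ψ e) w)                ≡⟨ length-++ (ψ e x) ⟩
  length (ψ e x) + length (apply (ψ e) w)        ≡⟨ cong (length (ψ e x) +_) (length-ψ e w) ⟩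
  length (ψ e x) + (suc e * length w + #b w)     ≡⟨ cong (_+ _) (length-ψ-letter x) ⟩
  (suc e + #b [ x ]) + (suc e * length w + #b w) ≡⟨ lemma (suc e) (#b [ x ]) (length w) (#b w) ⟩
  suc e * suc (length w) + (#b [ x ] + #b w)     ≡⟨ cong (suc e * suc (length w) +_) (sym (#b-++ [ x ] w)) ⟩
  suc e * suc (length w) + #b (x ∷ w)            ∎
  where
  open ≡-Reasoning
  lemma : ∀ d c l m → (d + c) + (d * l + m) ≡ d * suc l + (c + m)
  lemma = solve-∀
  length-ψ-letter : ∀ x → length (ψ e x) ≡ suc e + #b [ x ]
  length-ψ-letter a = trans (length-++ (replicate e a)) (trans (cong (_+ 1) (length-replicate e)) (trans (+-comm e 1) (sym (+-identityʳ (suc e)))))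
  length-ψ-letter b = trans (length-++ (replicate e a)) (trans (cong (_+ 2) (length-replicate e)) (+-suc e 1))

replicate-≼ : ∀ e v {y} → (∀ j → j < e → y j ≡ a) → v ≼ dropω e y → (replicate e a ++ v) ≼ y
replicate-≼ zero    v as v≼ = v≼
replicate-≼ (suc e) v as v≼ = sym (as 0 (s≤s z≤n)) , replicate-≼ e v (λ j j<e → as (suc j) (s≤s j<e)) v≼

cβ : ℕ → InfWord
cβ r = mechanical (floorβ r)

-- a word whose b's sit at the positions threshold r (1 + e) k − 1 is the ψ e-image of c_β
module Coding (r : ℕ) (1≤r : 1 ≤ r) (e : ℕ) (F : ℕ → ℕ)
              (≤F⇔ : ∀ n k → 1 ≤ k → k ≤ F n ⇔ threshold r (suc e) k < n) where

  private
    module β = Mechanical (floorβ r) (threshold r r) (≤floorβ⇔threshold< r 1≤r) (threshold-< r 1≤r r 1≤r) (threshold-0 r r)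
    module W = Mechanical F (threshold r (suc e)) ≤F⇔ (threshold-< r 1≤r (suc e) (s≤s z≤n)) (threshold-0 r (suc e))

  block-start : ℕ → ℕ
  block-start n = suc e * n + floorβ r (suc n)

  threshold-block-start : ∀ n → threshold r (suc e) (suc n) ≡ block-start n + suc e
  threshold-block-start n = shift (suc e) n (floorβ r (suc n))
    where
    shift : ∀ d n g → d * suc n + g ≡ (d * n + g) + d
    shift = solve-∀

  block-a : ∀ n j → j < e → mechanical F (block-start n + j) ≡ a
  block-a n j j<e = W.mechanical-a (block-start n + j) n
    (s≤s (≤-trans (+-monoʳ-≤ (suc e * n) (floorβ-mono r 1≤r n)) (m≤m+n (block-start n) j)))
    (subst₂ _<_ (+-suc (block-start n) j) (sym (threshold-block-start n)) (+-monoʳ-< (block-start n) (s≤s j<e)))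

  block-b : ∀ n → mechanical F (block-start n + (e + 0)) ≡ b
  block-b n = W.mechanical-b (block-start n + (e + 0)) (suc n) (s≤s z≤n) (begin
    suc (block-start n + (e + 0)) ≡⟨ cong (λ x → suc (block-start n + x)) (+-identityʳ e) ⟩
    suc (block-start n + e)       ≡⟨ sym (+-suc (block-start n) e) ⟩
    block-start n + suc e         ≡⟨ sym (threshold-block-start n) ⟩
    threshold r (suc e) (suc n)   ∎)
    where open ≡-Reasoning

  block-b-a : ∀ n → cβ r n ≡ b → mechanical F (block-start n + (e + 1)) ≡ a
  block-b-a n cβn = W.mechanical-a (block-start n + (e + 1)) (suc n)
    (subst (_< suc (block-start n + (e + 1))) (sym (threshold-block-start n)) (s≤s (≤-reflexive (shift₁ (block-start n) e))))
    (subst (suc (block-start n + (e + 1)) <_) (sym threshold≡) (m<m+n _ (s≤s z≤n)))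
    where
    shift₁ : ∀ S e → S + suc e ≡ S + (e + 1)
    shift₁ = solve-∀
    shift₂ : ∀ e n g → suc e * suc (suc n) + suc g ≡ suc ((suc e * n + g) + (e + 1)) + suc e
    shift₂ = solve-∀
    threshold≡ : threshold r (suc e) (suc (suc n)) ≡ suc (block-start n + (e + 1)) + suc e
    threshold≡ = trans (cong (suc e * suc (suc n) +_) (β.F-b n cβn)) (shift₂ e n (floorβ r (suc n)))

  ψ-block-≼ : ∀ n → ψ e (cβ r n) ≼ dropω (block-start n) (mechanical F)
  ψ-block-≼ n with cβ r n in cβn
  ... | a = replicate-≼ e (b ∷ []) (block-a n) (sym (block-b n) , tt)
  ... | b = replicate-≼ e (b ∷ a ∷ []) (block-a n) (sym (block-b n) , sym (block-b-a n cβn) , tt)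

  ψ-takeω-≼ : ∀ n → apply (ψ e) (takeω n (cβ r)) ≼ mechanical F
  ψ-takeω-≼ zero    = tt
  ψ-takeω-≼ (suc n) = subst (_≼ mechanical F) (sym apply≡)
    (≼-++⁺ (apply (ψ e) (takeω n (cβ r))) (ψ-takeω-≼ n)
      (subst (λ i → (ψ e (cβ r n) ++ []) ≼ dropω i (mechanical F)) (sym length≡) block≼))
    where
    apply≡ : apply (ψ e) (takeω (suc n) (cβ r)) ≡ apply (ψ e) (takeω n (cβ r)) ++ (ψ e (cβ r n) ++ [])
    apply≡ = trans (cong (apply (ψ e)) (takeω-suc n (cβ r))) (concatMap-++ (ψ e) (takeω n (cβ r)) [ cβ r n ])
    length≡ : length (apply (ψ e) (takeω n (cβ r))) ≡ block-start n
    length≡ = trans (length-ψ e (takeω n (cβ r))) (cong₂ (λ l m → suc e * l + m) (length-takeω n (cβ r)) (β.#b-takeω n))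
    block≼ : (ψ e (cβ r n) ++ []) ≼ dropω (block-start n) (mechanical F)
    block≼ = subst (_≼ dropω (block-start n) (mechanical F)) (sym (++-identityʳ (ψ e (cβ r n)))) (ψ-block-≼ n)

  ψ-≼ : ∀ w → w ≼ cβ r → apply (ψ e) w ≼ mechanical F
  ψ-≼ w w≼ = subst (λ u → apply (ψ e) u ≼ mechanical F) (sym (≼⇒≡takeω w w≼)) (ψ-takeω-≼ (length w))

-- Conjugate morphisms

drop-length-++ : ∀ (u t : Word) → drop (length u) (u ++ t) ≡ t
drop-length-++ []      t = refl
drop-length-++ (x ∷ u) t = drop-length-++ u t

drop-++-≥ : ∀ k (A B : Word) → length A ≤ k → drop k (A ++ B) ≡ drop (k ∸ length A) B
drop-++-≥ k       []      B _         = refl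
drop-++-≥ (suc k) (x ∷ A) B (s≤s |A|≤k) = drop-++-≥ k A B |A|≤k

drop-++-≤ : ∀ k (A B : Word) → k ≤ length A → drop k (A ++ B) ≡ drop k A ++ B
drop-++-≤ zero    A       B _         = refl
drop-++-≤ (suc k) (x ∷ A) B (s≤s k≤|A|) = drop-++-≤ k A B k≤|A|

conjugate-apply : ∀ φ ξ u → (∀ x → φ x ++ u ≡ u ++ ξ x) → ∀ w → apply φ w ++ u ≡ u ++ apply ξ w
conjugate-apply φ ξ u conj []      = sym (++-identityʳ u)
conjugate-apply φ ξ u conj (x ∷ w) = begin
  (φ x ++ apply φ w) ++ u ≡⟨ ++-assoc (φ x) _ u ⟩
  φ x ++ (apply φ w ++ u) ≡⟨ cong (φ x ++_) (conjugate-apply φ ξ u conj w) ⟩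
  φ x ++ (u ++ apply ξ w) ≡⟨ sym (++-assoc (φ x) u _) ⟩
  (φ x ++ u) ++ apply ξ w ≡⟨ cong (_++ apply ξ w) (conj x) ⟩
  (u ++ ξ x) ++ apply ξ w ≡⟨ ++-assoc u (ξ x) _ ⟩
  u ++ (ξ x ++ apply ξ w) ∎
  where open ≡-Reasoning

conjugate : Morphism → Word → Morphism
conjugate φ u x = drop (length u) (φ x ++ u)

conjugate-letter : ∀ φ u → (∀ x → u ⊑ φ x ++ u) → ∀ x → φ x ++ u ≡ u ++ conjugate φ u x
conjugate-letter φ u u⊑ x with u⊑ x
... | t , e = trans (sym e) (cong (u ++_) (trans (sym (drop-length-++ u t)) (cong (drop (length u)) e)))

length-conjugate-apply : ∀ φ ξ u → (∀ w → apply φ w ++ u ≡ u ++ apply ξ w) →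
                         ∀ w → length (apply ξ w) ≡ length (apply φ w)
length-conjugate-apply φ ξ u conj w = +-cancelˡ-≡ (length u) _ _ (begin
  length u + length (apply ξ w) ≡⟨ sym (length-++ u) ⟩
  length (u ++ apply ξ w)       ≡⟨ cong length (sym (conj w)) ⟩
  length (apply φ w ++ u)       ≡⟨ length-++ (apply φ w) ⟩
  length (apply φ w) + length u ≡⟨ +-comm (length (apply φ w)) (length u) ⟩
  length u + length (apply φ w) ∎)
  where open ≡-Reasoning

conjugate-image : ∀ φ ξ y k → (∀ x → 1 ≤ length (φ x)) → (∀ n → apply φ (takeω n y) ≼ y) →
                  (∀ w → apply φ w ++ takeω k y ≡ takeω k y ++ apply ξ w) → IsImage ξ y (dropω k y)
conjugate-image φ ξ y k φ-nonErasing φ-≼ conj n =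
  subst (λ i → apply ξ T ≼ dropω i y) (length-takeω k y) (proj₂ (≼-++⁻ u uξT≼))
  where
  u = takeω k y
  T = takeω n y
  R = takeω k (dropω n y)
  W≡ : takeω (n + k) y ≡ T ++ R
  W≡ = takeω-+ n k y
  uξT⊑ : u ++ apply ξ T ⊑ apply φ (T ++ R) ++ u
  uξT⊑ = subst (u ++ apply ξ T ⊑_) (sym (conj (T ++ R))) (++⁺-⊑ u (apply-⊑ ξ (⊑-++ T R)))
  length≤ : length (u ++ apply ξ T) ≤ length (apply φ (T ++ R))
  length≤ = begin
    length (u ++ apply ξ T)                      ≡⟨ length-++ u ⟩
    length u + length (apply ξ T)                ≡⟨ cong₂ _+_ (length-takeω k y) (length-conjugate-apply φ ξ u conj T) ⟩
    k + length (apply φ T)                       ≡⟨ +-comm k _ ⟩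
    length (apply φ T) + k                       ≤⟨ +-monoʳ-≤ (length (apply φ T))
                                                      (subst (_≤ length (apply φ R)) (length-takeω k (dropω n y)) (length-apply-≥ φ φ-nonErasing R)) ⟩
    length (apply φ T) + length (apply φ R)      ≡⟨ sym (length-++ (apply φ T)) ⟩
    length (apply φ T ++ apply φ R)              ≡⟨ cong length (sym (concatMap-++ φ T R)) ⟩
    length (apply φ (T ++ R))                    ∎
    where open ≤-Reasoning
  uξT≼ : (u ++ apply ξ T) ≼ y
  uξT≼ = ⊑-≼ (⊑-++-shorter _ _ uξT⊑ length≤) (subst (λ w → apply φ w ≼ y) W≡ (φ-≼ (n + k)))

⊑-++-self : ∀ {y} X P Z u → X ≼ y → P ≼ y → Z ≼ y → Z ⊑ X ++ P → u ≼ y → length u ≤ length Z → u ⊑ X ++ u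
⊑-++-self X P Z u X≼ P≼ Z≼ Z⊑XP u≼ |u|≤|Z| with length u ≤? length X
... | yes |u|≤|X| = ⊑-trans (≼-≼⇒⊑ u X u≼ X≼ |u|≤|X|) (⊑-++ X u)
... | no  |u|≰|X| with ≼-≼⇒⊑ X u X≼ u≼ (<⇒≤ (≰⇒> |u|≰|X|))
...   | u₁ , refl = ++⁺-⊑ X (≼-≼⇒⊑ u₁ (X ++ u₁) u₁≼ u≼ (length-++-≤ʳ u₁ {X}))
  where
  u₁⊑P : u₁ ⊑ P
  u₁⊑P = ++⁻-⊑ X (⊑-trans (≼-≼⇒⊑ (X ++ u₁) Z u≼ Z≼ |u|≤|Z|) Z⊑XP)
  u₁≼ : u₁ ≼ _
  u₁≼ = ⊑-≼ u₁⊑P P≼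

dropLast-++ : ∀ (u : Word) c t → dropLast (u ++ c ∷ t) ≡ u ++ dropLast (c ∷ t)
dropLast-++ []          c t = refl
dropLast-++ (x ∷ [])    c t = refl
dropLast-++ (x ∷ y ∷ u) c t = cong (x ∷_) (dropLast-++ (y ∷ u) c t)

dropLast-snoc : ∀ (w : Word) x → dropLast (w ++ [ x ]) ≡ w
dropLast-snoc w x = trans (dropLast-++ w x []) (++-identityʳ w)

length-dropLast : ∀ (w : Word) → length (dropLast w) ≡ length w ∸ 1
length-dropLast []          = refl
length-dropLast (x ∷ [])    = refl
length-dropLast (x ∷ y ∷ w) = cong suc (length-dropLast (y ∷ w))

dropLast-⊑ : ∀ (w : Word) → dropLast w ⊑ w
dropLast-⊑ []          = [] , refl
dropLast-⊑ (x ∷ [])    = x ∷ [] , refl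
dropLast-⊑ (x ∷ y ∷ w) = ∷-⊑ x (dropLast-⊑ (y ∷ w))

-- The standard words s_j are prefixes of c_α

ψ-a-⊑ : ∀ e x → ψ e a ⊑ ψ e x
ψ-a-⊑ e a = ⊑-refl (ψ e a)
ψ-a-⊑ e b = ++⁺-⊑ (replicate e a) (∷-⊑ b (a ∷ [] , refl))

ψ1-replicate : ∀ t → apply (ψ 1) (replicate t a) ≡ (a ∷ b ∷ []) ^ʷ t
ψ1-replicate zero    = refl
ψ1-replicate (suc t) = cong (λ w → a ∷ b ∷ w) (ψ1-replicate t)

odd-suc-suc : ∀ j → odd (suc (suc j)) ≡ odd j
odd-suc-suc j with odd j
... | true  = refl
... | false = refl

module Standard (r′ : ℕ) where

  r : ℕ
  r = suc r′

  1≤r : 1 ≤ r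
  1≤r = s≤s z≤n

  ab : Word
  ab = a ∷ b ∷ []

  ν φ : Morphism
  ν = ψ 1
  φ = ψ r′

  ν-≼ : ∀ w → w ≼ cβ r → apply ν w ≼ cα r
  ν-≼ = Coding.ψ-≼ r 1≤r 1 (floorα r) (≤floorα⇔threshold< r 1≤r)

  φ-≼ : ∀ w → w ≼ cβ r → apply φ w ≼ cβ r
  φ-≼ = Coding.ψ-≼ r 1≤r r′ (floorβ r) (≤floorβ⇔threshold< r 1≤r)

  σ-ν : ∀ x → apply (σ r) (ν x) ≡ apply ν (φ x)
  σ-ν a = begin
    ab ++ ((ab ^ʷ r′ ++ a ∷ []) ++ [])        ≡⟨ cong (ab ++_) (++-identityʳ _) ⟩
    ab ++ (ab ^ʷ r′ ++ a ∷ [])                ≡⟨ sym (++-assoc ab (ab ^ʷ r′) _) ⟩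
    (ab ++ ab ^ʷ r′) ++ a ∷ []                ≡⟨ cong (_++ a ∷ []) (^ʷ-comm ab r′) ⟩
    (ab ^ʷ r′ ++ ab) ++ a ∷ []                ≡⟨ ++-assoc (ab ^ʷ r′) ab _ ⟩
    ab ^ʷ r′ ++ a ∷ b ∷ a ∷ []                ≡⟨ cong (_++ a ∷ b ∷ a ∷ []) (sym (ψ1-replicate r′)) ⟩
    apply ν (replicate r′ a) ++ apply ν [ b ] ≡⟨ sym (concatMap-++ ν (replicate r′ a) [ b ]) ⟩
    apply ν (φ a)                             ∎
    where open ≡-Reasoning
  σ-ν b = begin
    ab ++ ((ab ^ʷ r′ ++ a ∷ []) ++ ab)               ≡⟨ cong (ab ++_) (++-assoc (ab ^ʷ r′) _ _) ⟩
    ab ++ (ab ^ʷ r′ ++ a ∷ a ∷ b ∷ [])               ≡⟨ sym (++-assoc ab (ab ^ʷ r′) _) ⟩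
    (ab ++ ab ^ʷ r′) ++ a ∷ a ∷ b ∷ []               ≡⟨ cong (_++ a ∷ a ∷ b ∷ []) (^ʷ-comm ab r′) ⟩
    (ab ^ʷ r′ ++ ab) ++ a ∷ a ∷ b ∷ []               ≡⟨ ++-assoc (ab ^ʷ r′) ab _ ⟩
    ab ^ʷ r′ ++ a ∷ b ∷ a ∷ a ∷ b ∷ []               ≡⟨ cong (_++ a ∷ b ∷ a ∷ a ∷ b ∷ []) (sym (ψ1-replicate r′)) ⟩
    apply ν (replicate r′ a) ++ apply ν (b ∷ a ∷ []) ≡⟨ sym (concatMap-++ ν (replicate r′ a) (b ∷ a ∷ [])) ⟩
    apply ν (φ b)                                    ∎
    where open ≡-Reasoning

  σ-pow-ν : ∀ j → pow (σ r) (suc j) a ≡ apply ν (pow φ j a)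
  σ-pow-ν zero    = refl
  σ-pow-ν (suc j) = begin
    apply (σ r) (pow (σ r) (suc j) a)   ≡⟨ cong (apply (σ r)) (σ-pow-ν j) ⟩
    apply (σ r) (apply ν (pow φ j a))   ≡⟨ apply-apply (σ r) ν (pow φ j a) ⟩
    apply (apply (σ r) ∘ ν) (pow φ j a) ≡⟨ concatMap-cong σ-ν (pow φ j a) ⟩
    apply (apply ν ∘ φ) (pow φ j a)     ≡⟨ sym (apply-apply ν φ (pow φ j a)) ⟩
    apply ν (pow φ (suc j) a)           ∎
    where open ≡-Reasoning

  φ-pow-≼ : ∀ j → pow φ (suc j) a ≼ cβ r
  φ-pow-≼ zero    = subst (_≼ cβ r) (sym (++-identityʳ (φ a)))
    (⊑-≼ (⊑-trans (ψ-a-⊑ r′ (cβ r 0)) (⊑-++ _ [])) (φ-≼ (takeω 1 (cβ r)) (takeω-≼ 1 (cβ r))))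
  φ-pow-≼ (suc j) = φ-≼ _ (φ-pow-≼ j)

  σ-pow-≼ : ∀ j → pow (σ r) (suc j) a ≼ cα r
  σ-pow-≼ zero    =
    ⊑-≼ (⊑-trans (ψ-a-⊑ 1 (cβ r 0)) (⊑-++ _ [])) (ν-≼ (takeω 1 (cβ r)) (takeω-≼ 1 (cβ r)))
  σ-pow-≼ (suc j) = subst (_≼ cα r) (sym (σ-pow-ν (suc j))) (ν-≼ _ (φ-pow-≼ j))

  σ-pow-s : ∀ j → pow (σ r) (suc j) a ≡ s r (suc j) × pow (σ r) (suc j) b ≡ s r (suc j) ^ʷ r′ ++ s r j
  σ-pow-s zero    = refl , ++-identityʳ _
  σ-pow-s (suc j) = σ²a , σ²b
    where
    X = s r (suc j)
    Y = s r j
    σʲ = pow (σ r) (suc j)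
    σa≡ = proj₁ (σ-pow-s j)
    σb≡ = proj₂ (σ-pow-s j)
    pow-suc : ∀ x → pow (σ r) (suc (suc j)) x ≡ apply σʲ (pow (σ r) 1 x)
    pow-suc x = trans (cong (λ n → pow (σ r) (suc n) x) (+-comm 1 j)) (sym (apply-pow (σ r) (suc j) 1 x))
    σ²a : pow (σ r) (suc (suc j)) a ≡ s r (suc (suc j))
    σ²a = begin
      pow (σ r) (suc (suc j)) a   ≡⟨ pow-suc a ⟩
      σʲ a ++ (σʲ b ++ [])        ≡⟨ cong₂ (λ u v → u ++ (v ++ [])) σa≡ σb≡ ⟩
      X ++ ((X ^ʷ r′ ++ Y) ++ []) ≡⟨ cong (X ++_) (++-identityʳ (X ^ʷ r′ ++ Y)) ⟩
      X ++ (X ^ʷ r′ ++ Y)         ≡⟨ sym (++-assoc X (X ^ʷ r′) Y) ⟩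
      (X ++ X ^ʷ r′) ++ Y         ∎
      where open ≡-Reasoning
    σ²b : pow (σ r) (suc (suc j)) b ≡ s r (suc (suc j)) ^ʷ r′ ++ X
    σ²b = begin
      pow (σ r) (suc (suc j)) b             ≡⟨ pow-suc b ⟩
      apply σʲ ((ab ^ʷ r′ ++ a ∷ []) ++ []) ≡⟨ cong (apply σʲ) (++-identityʳ (ab ^ʷ r′ ++ a ∷ [])) ⟩
      apply σʲ (ab ^ʷ r′ ++ a ∷ [])         ≡⟨ concatMap-++ σʲ (ab ^ʷ r′) [ a ] ⟩
      apply σʲ (ab ^ʷ r′) ++ (σʲ a ++ [])   ≡⟨ cong₂ _++_ (apply-^ʷ σʲ ab r′) (++-identityʳ (σʲ a)) ⟩
      apply σʲ ab ^ʷ r′ ++ σʲ a             ≡⟨ cong₂ (λ u v → u ^ʷ r′ ++ v) (trans (sym (pow-suc a)) σ²a) σa≡ ⟩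
      s r (suc (suc j)) ^ʷ r′ ++ X          ∎
      where open ≡-Reasoning

  s-≼ : ∀ j → s r j ≼ cα r
  s-≼ zero    = ⊑-≼ {s r 0} {s r 1} {cα r} (b ∷ [] , refl) (s-≼ 1)
  s-≼ (suc j) = subst (_≼ cα r) (proj₁ (σ-pow-s j)) (σ-pow-≼ j)

  length-s : ∀ j → length (s r j) ≡ q r j
  length-s zero          = refl
  length-s (suc zero)    = refl
  length-s (suc (suc j)) = trans (length-++ (s r (suc j) ^ʷ r))
    (cong₂ _+_ (trans (length-^ʷ (s r (suc j)) r) (cong (r *_) (length-s (suc j)))) (length-s j))

  q-≤-suc : ∀ j → q r j ≤ q r (suc j)
  q-≤-suc zero    = s≤s z≤n
  q-≤-suc (suc j) = ≤-trans (m≤m+n (q r (suc j)) _) (m≤m+n (r * q r (suc j)) (q r j))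

  q-pos : ∀ j → 1 ≤ q r j
  q-pos zero    = s≤s z≤n
  q-pos (suc j) = ≤-trans (q-pos j) (q-≤-suc j)

  n<q : ∀ j → j < q r j
  n<q zero          = s≤s z≤n
  n<q (suc zero)    = s≤s (s≤s z≤n)
  n<q (suc (suc j)) = ≤-trans (subst (_≤ q r (suc j) + q r j) (+-comm (suc (suc j)) 1) (+-mono-≤ (n<q (suc j)) (q-pos j)))
                              (+-monoˡ-≤ (q r j) (m≤m+n (q r (suc j)) (r′ * q r (suc j))))

  -- the letter removed from the end of s_{j+1} in v_j
  s-last : ∀ j → ∃ λ w → s r (suc j) ≡ w ++ [ if odd j then a else b ]
  s-last zero          = a ∷ [] , refl
  s-last (suc zero)    = ab ^ʷ r , refl
  s-last (suc (suc j)) with s-last j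
  ... | w , e = X ^ʷ r ++ w , (begin
    X ^ʷ r ++ s r (suc j)                                   ≡⟨ cong (X ^ʷ r ++_) e ⟩
    X ^ʷ r ++ w ++ [ if odd j then a else b ]               ≡⟨ sym (++-assoc (X ^ʷ r) w _) ⟩
    (X ^ʷ r ++ w) ++ [ if odd j then a else b ]             ≡⟨ cong (λ o → (X ^ʷ r ++ w) ++ [ if o then a else b ]) (sym (odd-suc-suc j)) ⟩
    (X ^ʷ r ++ w) ++ [ if odd (suc (suc j)) then a else b ] ∎)
    where
    open ≡-Reasoning
    X = s r (suc (suc j))

  s-head : ∀ j → ∃ λ t → s r j ≡ a ∷ t
  s-head zero          = [] , refl
  s-head (suc zero)    = b ∷ [] , refl
  s-head (suc (suc j)) with s-head (suc j)
  ... | t , e = (t ++ s r (suc j) ^ʷ r′) ++ s r j , cong (λ w → (w ++ s r (suc j) ^ʷ r′) ++ s r j) e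

  s⊑s-suc : ∀ j → s r j ⊑ s r (suc j)
  s⊑s-suc zero    = b ∷ [] , refl
  s⊑s-suc (suc j) = s r (suc j) ^ʷ r′ ++ s r j , sym (++-assoc (s r (suc j)) (s r (suc j) ^ʷ r′) (s r j))

  dropLast-s-suc : ∀ j → dropLast (s r (suc j)) ≡ dropLast (s r j) ++ v' r j
  dropLast-s-suc zero    = refl
  dropLast-s-suc (suc j) with s-last j | s-head j
  ... | D , eD | t , et = begin
    dropLast ((X ++ X ^ʷ r′) ++ Y)         ≡⟨ cong dropLast (++-assoc X (X ^ʷ r′) Y) ⟩
    dropLast (X ++ Z)                      ≡⟨ cong (λ w → dropLast (w ++ Z)) eD ⟩
    dropLast ((D ++ [ x ]) ++ Z)           ≡⟨ cong dropLast (++-assoc D [ x ] Z) ⟩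
    dropLast (D ++ x ∷ Z)                  ≡⟨ dropLast-++ D x Z ⟩
    D ++ dropLast (x ∷ Z)                  ≡⟨ cong (λ w → D ++ dropLast (x ∷ w)) eZ ⟩
    D ++ dropLast ((x ∷ X ^ʷ r′) ++ a ∷ t) ≡⟨ cong (D ++_) (dropLast-++ (x ∷ X ^ʷ r′) a t) ⟩
    D ++ x ∷ (X ^ʷ r′ ++ dropLast (a ∷ t)) ≡⟨ cong (λ w → D ++ x ∷ w) (sym (dropLast-++ (X ^ʷ r′) a t)) ⟩
    D ++ x ∷ dropLast (X ^ʷ r′ ++ a ∷ t)   ≡⟨ cong (λ w → D ++ x ∷ dropLast w) (sym eZ) ⟩
    D ++ v r j                             ≡⟨ cong (_++ v r j) (sym (trans (cong dropLast eD) (dropLast-snoc D x))) ⟩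
    dropLast X ++ v r j                    ∎
    where
    open ≡-Reasoning
    X = s r (suc j)
    Y = s r j
    Z = X ^ʷ r′ ++ Y
    x = if odd j then a else b
    eZ : Z ≡ X ^ʷ r′ ++ a ∷ t
    eZ = cong (X ^ʷ r′ ++_) et

  length-v' : ∀ m → length (v' r m) ≡ q r (suc m) ∸ q r m
  length-v' zero    = refl
  length-v' (suc j) with s-head j
  ... | t , et = begin
    suc (length (dropLast Z))                                ≡⟨ cong suc (length-dropLast Z) ⟩
    suc (length Z ∸ 1)                                       ≡⟨ cong (λ w → suc (length w ∸ 1)) eZ ⟩
    suc (length (X ^ʷ r′ ++ a ∷ t) ∸ 1)                      ≡⟨ cong (λ n → suc (n ∸ 1)) (length-++ (X ^ʷ r′)) ⟩
    suc (length (X ^ʷ r′) + suc (length t) ∸ 1)              ≡⟨ cong (λ n → suc (n ∸ 1)) (+-suc (length (X ^ʷ r′)) (length t)) ⟩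
    suc (length (X ^ʷ r′) + length t)                        ≡⟨ sym (+-suc (length (X ^ʷ r′)) (length t)) ⟩
    length (X ^ʷ r′) + length (a ∷ t)                        ≡⟨ cong (λ w → length (X ^ʷ r′) + length w) (sym et) ⟩
    length (X ^ʷ r′) + length Y                              ≡⟨ cong₂ _+_ (trans (length-^ʷ X r′) (cong (r′ *_) (length-s (suc j)))) (length-s j) ⟩
    r′ * q r (suc j) + q r j                                 ≡⟨ sym (m+n∸m≡n (q r (suc j)) _) ⟩
    (q r (suc j) + (r′ * q r (suc j) + q r j)) ∸ q r (suc j) ≡⟨ cong (_∸ q r (suc j)) (sym (+-assoc (q r (suc j)) _ (q r j))) ⟩
    q r (suc (suc j)) ∸ q r (suc j)                          ∎
    where
    open ≡-Reasoning
    X = s r (suc j)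
    Y = s r j
    Z = X ^ʷ r′ ++ Y
    eZ : Z ≡ X ^ʷ r′ ++ a ∷ t
    eZ = cong (X ^ʷ r′ ++_) et

  s-swap : ∀ j → ∃ λ w → ∃ λ c → ∃ λ d →
           s r (suc j) ++ s r j ≡ w ++ c ∷ d ∷ [] × s r j ++ s r (suc j) ≡ w ++ d ∷ c ∷ []
  s-swap zero    = a ∷ [] , b , a , refl , refl
  s-swap (suc j) with s-swap j
  ... | w , c , d , e₁ , e₂ = P ++ w , d , c , e₁′ , e₂′
    where
    X = s r (suc j)
    Y = s r j
    P = X ^ʷ r
    e₁′ : (P ++ Y) ++ X ≡ (P ++ w) ++ d ∷ c ∷ []
    e₁′ = trans (++-assoc P Y X) (trans (cong (P ++_) e₂) (sym (++-assoc P w _)))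
    e₂′ : X ++ (P ++ Y) ≡ (P ++ w) ++ c ∷ d ∷ []
    e₂′ = begin
      X ++ (P ++ Y)          ≡⟨ sym (++-assoc X P Y) ⟩
      (X ++ P) ++ Y          ≡⟨ cong (_++ Y) (^ʷ-comm X r) ⟩
      (P ++ X) ++ Y          ≡⟨ ++-assoc P X Y ⟩
      P ++ (X ++ Y)          ≡⟨ cong (P ++_) e₁ ⟩
      P ++ (w ++ c ∷ d ∷ []) ≡⟨ sym (++-assoc P w _) ⟩
      (P ++ w) ++ c ∷ d ∷ [] ∎
      where open ≡-Reasoning

  σ-pow-a : ∀ j → pow (σ r) j a ≡ s r j
  σ-pow-a zero    = refl
  σ-pow-a (suc j) = proj₁ (σ-pow-s j)

  σ-pow-nonErasing : ∀ m x → 1 ≤ length (pow (σ r) m x)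
  σ-pow-nonErasing zero    x = s≤s z≤n
  σ-pow-nonErasing (suc m) x = ≤-trans (σ-pow-nonErasing m x) (length-apply-≥ (σ r) σ-nonErasing (pow (σ r) m x))
    where
    σ-nonErasing : ∀ x → 1 ≤ length (σ r x)
    σ-nonErasing a = s≤s z≤n
    σ-nonErasing b = subst (1 ≤_) (sym (length-++ (ab ^ʷ r′))) (m≤n+m 1 _)

  σ-pow-takeω-≼ : ∀ m n → apply (pow (σ r) m) (takeω n (cα r)) ≼ cα r
  σ-pow-takeω-≼ m n = ⊑-≼ (apply-⊑ (pow (σ r) m) takeω⊑s) σᵐs≼
    where
    takeω⊑s : takeω n (cα r) ⊑ s r n
    takeω⊑s = ≼-≼⇒⊑ _ (s r n) (takeω-≼ n (cα r)) (s-≼ n)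
      (subst₂ _≤_ (sym (length-takeω n (cα r))) (sym (length-s n)) (<⇒≤ (n<q n)))
    σᵐs≼ : apply (pow (σ r) m) (s r n) ≼ cα r
    σᵐs≼ = subst (_≼ cα r) (sym (trans (cong (apply (pow (σ r) m)) (sym (σ-pow-a n)))
                                        (trans (apply-pow (σ r) m n a) (σ-pow-a (m + n)))))
                 (s-≼ (m + n))

  s-suc-suc-rotate : ∀ j → s r (suc (suc j)) ≡ s r (suc j) ^ʷ r′ ++ (s r (suc j) ++ s r j)
  s-suc-suc-rotate j = trans (cong (_++ Y) (^ʷ-comm X r′)) (++-assoc (X ^ʷ r′) X Y)
    where
    X = s r (suc j)
    Y = s r j

  σ-pow-b-≼ : ∀ j → (s r (suc j) ^ʷ r′ ++ s r j) ≼ cα r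
  σ-pow-b-≼ j = ⊑-≼ (subst (λ w → X ^ʷ r′ ++ Y ⊑ w) (sym (s-suc-suc-rotate j))
                           (++⁺-⊑ (X ^ʷ r′) (⊑-trans (s⊑s-suc j) (⊑-++ X Y))))
                    (s-≼ (suc (suc j)))
    where
    X = s r (suc j)
    Y = s r j

  length-takeω-≤-s : ∀ j k → 2 + k ≤ q r (suc (suc j)) → length (takeω k (cα r)) + 2 ≤ length (s r (suc (suc j)))
  length-takeω-≤-s j k 2+k≤ = subst₂ _≤_ (trans (+-comm 2 k) (cong (_+ 2) (sym (length-takeω k (cα r)))))
                                         (sym (length-s (suc (suc j)))) 2+k≤

  takeω-⊑-s-++ : ∀ j k → 2 + k ≤ q r (suc (suc j)) → takeω k (cα r) ⊑ s r (suc j) ++ takeω k (cα r)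
  takeω-⊑-s-++ j k 2+k≤ =
    ⊑-++-self X (X ^ʷ r′ ++ s r j) T u (s-≼ (suc j)) (σ-pow-b-≼ j) (s-≼ (suc (suc j))) T⊑ (takeω-≼ k (cα r))
      (≤-trans (m≤m+n (length u) 2) (length-takeω-≤-s j k 2+k≤))
    where
    u = takeω k (cα r)
    X = s r (suc j)
    T = s r (suc (suc j))
    T⊑ : T ⊑ X ++ (X ^ʷ r′ ++ s r j)
    T⊑ = subst (T ⊑_) (++-assoc X (X ^ʷ r′) (s r j)) (⊑-refl T)

  takeω-⊑-σ-pow-b-++ : ∀ j k → 2 + k ≤ q r (suc (suc j)) → takeω k (cα r) ⊑ (s r (suc j) ^ʷ r′ ++ s r j) ++ takeω k (cα r)
  takeω-⊑-σ-pow-b-++ j k 2+k≤ with s-swap j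
  ... | w , c , d , XY≡ , YX≡ =
    ⊑-++-self P X Z u (σ-pow-b-≼ j) (s-≼ (suc j)) Z≼ Z⊑PX (takeω-≼ k (cα r))
      (+-cancelʳ-≤ 2 _ _ (subst (length u + 2 ≤_) (trans (cong length T≡) (length-++ Z)) (length-takeω-≤-s j k 2+k≤)))
    where
    u = takeω k (cα r)
    X = s r (suc j)
    Y = s r j
    P = X ^ʷ r′ ++ Y
    Z = X ^ʷ r′ ++ w
    T≡ : s r (suc (suc j)) ≡ Z ++ c ∷ d ∷ []
    T≡ = trans (s-suc-suc-rotate j) (trans (cong (X ^ʷ r′ ++_) XY≡) (sym (++-assoc (X ^ʷ r′) w _)))
    Z≼ : Z ≼ cα r
    Z≼ = ⊑-≼ (c ∷ d ∷ [] , sym T≡) (s-≼ (suc (suc j)))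
    Z⊑PX : Z ⊑ P ++ X
    Z⊑PX = d ∷ c ∷ [] , sym (trans (++-assoc (X ^ʷ r′) Y X) (trans (cong (X ^ʷ r′ ++_) YX≡) (sym (++-assoc (X ^ʷ r′) w _))))

  takeω-⊑-σ-pow : ∀ m k → 2 + k ≤ q r (suc m) → ∀ x → takeω k (cα r) ⊑ pow (σ r) m x ++ takeω k (cα r)
  takeω-⊑-σ-pow zero    zero    _              x = _ , refl
  takeω-⊑-σ-pow zero    (suc k) (s≤s (s≤s ())) x
  takeω-⊑-σ-pow (suc j) k       2+k≤           a =
    subst (λ w → takeω k (cα r) ⊑ w ++ takeω k (cα r)) (sym (proj₁ (σ-pow-s j))) (takeω-⊑-s-++ j k 2+k≤)
  takeω-⊑-σ-pow (suc j) k       2+k≤           b =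
    subst (λ w → takeω k (cα r) ⊑ w ++ takeω k (cα r)) (sym (proj₂ (σ-pow-s j))) (takeω-⊑-σ-pow-b-++ j k 2+k≤)

  drop-dropLast-s : ∀ m k → length (dropLast (s r m)) ≤ k → k ∸ length (dropLast (s r m)) ≤ length (v' r m) →
    ∀ n → prodUpTo (rhsSeq r m (k ∸ length (dropLast (s r m)))) (suc n) ≡ drop k (dropLast (s r (m + suc n)))
        × k ≤ length (dropLast (s r (m + suc n)))
  drop-dropLast-s m k e≤k ℓ≤ zero = sym (trans (cong (drop k) D₁≡) (drop-++-≥ k D (v' r m) e≤k)) , k≤
    where
    D = dropLast (s r m)
    D₁≡ : dropLast (s r (m + 1)) ≡ D ++ v' r m
    D₁≡ = trans (cong (dropLast ∘ s r) (+-comm m 1)) (dropLast-s-suc m)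
    k≤ : k ≤ length (dropLast (s r (m + 1)))
    k≤ = subst (k ≤_) (sym (trans (cong length D₁≡) (trans (length-++ D) (+-comm (length D) _))))
           (subst (_≤ length (v' r m) + length D) (m∸n+n≡m e≤k) (+-monoˡ-≤ (length D) ℓ≤))
  drop-dropLast-s m k e≤k ℓ≤ (suc n) with drop-dropLast-s m k e≤k ℓ≤ n
  ... | prod≡ , k≤ = trans (cong (_++ v' r (suc (m + n))) prod≡) (trans (sym (drop-++-≤ k Dₙ _ k≤)) (cong (drop k) (sym Dₙ₊₁≡)))
                   , subst (k ≤_) (sym (trans (cong length Dₙ₊₁≡) (length-++ Dₙ))) (≤-trans k≤ (m≤m+n _ _))
    where
    Dₙ = dropLast (s r (m + suc n))
    Dₙ₊₁≡ : dropLast (s r (m + suc (suc n))) ≡ Dₙ ++ v' r (suc (m + n))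
    Dₙ₊₁≡ = trans (cong (dropLast ∘ s r) (+-suc m (suc n))) (trans (dropLast-s-suc (m + suc n)) (cong (λ i → Dₙ ++ v' r i) (+-suc m n)))

  s-product : ∀ m k → length (dropLast (s r m)) ≤ k → k ∸ length (dropLast (s r m)) ≤ length (v' r m) →
    IsInfProd (rhsSeq r m (k ∸ length (dropLast (s r m)))) (dropω k (cα r))
  s-product m k e≤k ℓ≤ zero    = tt
  s-product m k e≤k ℓ≤ (suc n) = subst (_≼ dropω k (cα r)) (sym (proj₁ (drop-dropLast-s m k e≤k ℓ≤ n)))
    (≼-drop k _ (⊑-≼ (dropLast-⊑ (s r (m + suc n))) (s-≼ (m + suc n))))

-- The index bookkeeping of the theorem, for Q₀ = q_m and Q₁ = q_{m+1}
indices : ∀ Q₀ Q₁ p → 1 ≤ Q₀ → Q₀ ≤ Q₁ → 2 ≤ p → p ≤ Q₁ ∸ Q₀ + 1 →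
  (Q₁ ∸ Q₀ + 1 ∸ p ≤ Q₁ ∸ Q₀) × (2 + (Q₁ ∸ p) ≤ Q₁) ×
  (Q₀ ∸ 1 ≤ Q₁ ∸ p) × (Q₁ ∸ p ∸ (Q₀ ∸ 1) ≡ Q₁ ∸ Q₀ + 1 ∸ p)
indices (suc e) Q₁ (suc zero)     _ _     (s≤s ()) _
indices (suc e) Q₁ (suc (suc p′)) _ Q₀≤Q₁ _ p≤ with m≤n⇒∃[o]m+o≡n Q₀≤Q₁
... | d , refl
  with m≤n⇒∃[o]m+o≡n (+-cancelʳ-≤ 1 (suc p′) d (subst₂ _≤_ (sym (+-comm (suc p′) 1)) (cong (_+ 1) (m+n∸m≡n (suc e) d)) p≤))
... | f , refl = subst₂ _≤_ (sym ℓ≡) (sym d≡) (m≤n+m f (suc p′))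
               , subst (λ x → 2 + x ≤ suc e + (suc p′ + f)) (sym k≡)
                       (subst (2 + (e + f) ≤_) (shift₁ e p′ f) (m≤m+n (2 + (e + f)) p′))
               , subst (e ≤_) (sym k≡) (m≤m+n e f)
               , trans (cong (_∸ e) k≡) (trans (m+n∸m≡n e f) (sym ℓ≡))
  where
  shift₁ : ∀ e p′ f → 2 + (e + f) + p′ ≡ suc e + (suc p′ + f)
  shift₁ = solve-∀
  shift₂ : ∀ e p′ f → suc e + (suc p′ + f) ≡ e + f + suc (suc p′)
  shift₂ = solve-∀
  shift₃ : ∀ p′ f → suc p′ + f + 1 ≡ f + suc (suc p′)
  shift₃ = solve-∀
  d≡ : suc e + (suc p′ + f) ∸ suc e ≡ suc p′ + f
  d≡ = m+n∸m≡n (suc e) (suc p′ + f)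
  k≡ : suc e + (suc p′ + f) ∸ suc (suc p′) ≡ e + f
  k≡ = trans (cong (_∸ suc (suc p′)) (shift₂ e p′ f)) (m+n∸n≡m (e + f) (suc (suc p′)))
  ℓ≡ : suc e + (suc p′ + f) ∸ suc e + 1 ∸ suc (suc p′) ≡ f
  ℓ≡ = trans (cong (λ x → x + 1 ∸ suc (suc p′)) d≡)
             (trans (cong (_∸ suc (suc p′)) (shift₃ p′ f)) (m+n∸n≡m f (suc (suc p′))))

lemma3p6 : (r : ℕ) → 1 ≤ r → (k m p : ℕ) →
    2 ≤ p → p ≤ q r (suc m) ∸ q r m + 1 → k ≡ q r (suc m) ∸ p →
    (q r (suc m) ∸ q r m + 1 ∸ p ≤ length (v' r m)) ×
    Σ Morphism (λ ξ → Σ Word (λ u →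
      (length u ≡ k) ×
      (∀ (w : Word) → apply (pow (σ r) m) w ++ u ≡ u ++ apply ξ w) ×
      ∃ (λ (y : InfWord) →
        IsImage ξ (cα r) y ×
        IsInfProd (λ i → rhsSeq r m (q r (suc m) ∸ q r m + 1 ∸ p) i) y)))
lemma3p6 (suc r′) _ k m p 2≤p p≤ refl =
  subst (_≤ length (v' r m)) ℓ≡ ℓ≤ , ξ , u , length-takeω k (cα r) , conj , dropω k (cα r) ,
  conjugate-image (pow (σ r) m) ξ (cα r) k (σ-pow-nonErasing m) (σ-pow-takeω-≼ m) conj ,
  subst (λ ℓ → IsInfProd (rhsSeq r m ℓ) (dropω k (cα r))) ℓ≡ (s-product m k e≤k ℓ≤)
  where
  open Standard r′
  u = takeω k (cα r)
  ξ = conjugate (pow (σ r) m) u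
  e≡ : length (dropLast (s r m)) ≡ q r m ∸ 1
  e≡ = trans (length-dropLast (s r m)) (cong (_∸ 1) (length-s m))
  bounds = indices (q r m) (q r (suc m)) p (q-pos m) (q-≤-suc m) 2≤p p≤
  ℓ≡ : k ∸ length (dropLast (s r m)) ≡ q r (suc m) ∸ q r m + 1 ∸ p
  ℓ≡ = trans (cong (k ∸_) e≡) (proj₂ (proj₂ (proj₂ bounds)))
  ℓ≤ : k ∸ length (dropLast (s r m)) ≤ length (v' r m)
  ℓ≤ = subst₂ _≤_ (sym ℓ≡) (sym (length-v' m)) (proj₁ bounds)
  e≤k : length (dropLast (s r m)) ≤ k
  e≤k = subst (_≤ k) (sym e≡) (proj₁ (proj₂ (proj₂ bounds)))
  conj : ∀ w → apply (pow (σ r) m) w ++ u ≡ u ++ apply ξ w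
  conj = conjugate-apply _ ξ u (conjugate-letter _ u (takeω-⊑-σ-pow m k (proj₁ (proj₂ bounds))))
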